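{- Let $G$ be a (connected) ribbon graph cellularly embedded in a closed orientable surface $\Sigma$, with a fixed reference orientation. Let $\bar\varphi: Jac(\mathcal{C}(G,\Sigma))\to S(G^{\bowtie})$ be the group isomorphism induced by the linear map $\varphi:\mathbb{Z}^{E(G)}\to\mathbb{Z}^{E(G)}_0$, $\varphi(\mathbf{1}_e)=-\chi_{{\rm med}^+(e)}$. Then the canonical Bernardi action $\Gamma$ of $Jac(\mathcal{C}(G,\Sigma))$ on spanning quasi-trees of $G$ agrees with the tour-rotor action of $S(G^{\bowtie})$ transported via Bouchet's bijection: for every $\mathbf{v}\in Jac(\mathcal{C}(G,\Sigma))$ and every spanning quasi-tree $Q$, if $\mathcal{E}_Q$ denotes the Eulerian tour of $G^{\bowtie}$ corresponding to $Q$, then $r(\bar\varphi(\mathbf{v}),\mathcal{E}_Q)=\mathcal{E}_{\Gamma(\mathbf{v},Q)}$.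
   Context: Setting. $G^*$ is the dual of $G$ in $\Sigma$; $e$ and $e^*$ cross at $v_e$. Orient $e^*$ by rotating the reference orientation of $e$ positively. ${\rm primal}^\pm(e)$ is the half of $e$ (on either side of $v_e$) containing the head/tail of $e$; ${\rm dual}^\pm(e)$ is the half of $e^*$ containing the head/tail of $e^*$. A spanning quasi-tree is a spanning subgraph whose neighbourhood in $\Sigma$ has one boundary component. Medial digraph $G^{\bowtie}$: nodes $v_e$, and for each vertex $v$ and end of $e$ at $v$ an arc $v_e\to v_f$, $f$'s end following $e$'s end at $v$; around $v_e$ in positive order: half of $e$, in-arc, half of $e^*$, out-arc, half of $e$, in-arc, half of $e^*$, out-arc. ${\rm med}^-(e)$ is the out-arc of $v_e$ between ${\rm dual}^-(e)$ and ${\rm primal}^+(e)$; ${\rm med}^+(e)$ the out-arc between ${\rm dual}^+(e)$ and ${\rm primal}^-(e)$. For an arc $f$ from $a$ to $b$, $\chi_f=\mathbf{1}_b-\mathbf{1}_a$. $S(G^{\bowtie})=\mathbb{Z}^{E}_0/\sim$ (zero-sum vectors on nodes modulo firings). Each passage of an Eulerian tour through $v_e$ goes from an in-arc to the next-but-one... i.e. to an out-arc and crosses the half-edge lying between them (of $e$ or of $e^*$); a tour crosses either both halves of $e$ or both halves of $e^*$. Bouchet's bijection sends a tour to $Q=\{e:$ the tour does not cross $e\}$, a bijection onto spanning quasi-trees; $\mathcal{E}_Q$ is its inverse. Tour-rotor action: every Eulerian tour of $G^{\bowtie}$ is compatible (out-degrees are 2). For an arc $\overrightarrow{ab}$, $A_{\overrightarrow{ab}}(\mathcal{E})$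 is the in-arborescence rooted at $a$ of last-traversed out-arcs when $\mathcal{E}$ starts with $\overrightarrow{ab}$. A routing at a node on $(x,\varrho)$ ($\varrho$ a choice of out-arc per node) switches its rotor to its other out-arc and moves one chip from the node to that arc's head; $\sim$ on such pairs is reachability by routings. $r(x,\mathcal{E})=\mathcal{E}'$ iff $(x,A_{\overrightarrow{ab}}(\mathcal{E})\cup\{\overrightarrow{ab}\})\sim(\mathbf{0},A_{\overrightarrow{ab}}(\mathcal{E}')\cup\{\overrightarrow{ab}\})$ for some (equivalently any) arc $\overrightarrow{ab}$. Jacobian: a cycle is a minimal $C\subseteq E(G)\sqcup E(G^*)$ containing at most one of $e,e^*$ for each $e$ with $\Sigma\setminus C$ having two components; a signed cycle is $\partial D$ for a component $D$, with entry $\pm1$ on $e\in C$ according as the boundary orientation agrees with the reference orientation. $\pi(z)(e)=z(e)+z(e^*)$. $x_1\sim_J x_2$ iff $x_1-x_2$ lies in the integer span of $\pi$ of signed cycles; $Jac(\mathcal{C}(G,\Sigma))=\mathbb{Z}^{E(G)}/\sim_J$. Orientations of $G$ are vectors $\mathbf{O}\in\{\pm\tfrac12\}^{E(G)}$ ($+\tfrac12$ = agrees with reference); circuit reversal classes are classes of $\sim_J$ restricted to orientations. $Jac$ acts simply transitively on circuit reversal classes by $\mathbf{v}\cdot[\mathbf{O}_1]=[\mathbf{O}_2]$ iff $\mathbf{v}+\mathbf{O}_1\sim_J\mathbf{O}_2$. Bernardi bijection (fix $e_0\in E(G)$): for a quasi-tree $Q$, number the half-edges crossed by $\mathcal{E}_Q$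 in order of crossing, starting with whichever of ${\rm primal}^-(e_0)$, ${\rm dual}^+(e_0)$ is crossed. Set $\mathbf{O}_Q(e)=+\tfrac12$ iff either $e\notin Q$ and ${\rm primal}^+(e)$ is crossed before ${\rm primal}^-(e)$, or $e\in Q$ and ${\rm dual}^-(e)$ is crossed before ${\rm dual}^+(e)$; otherwise $-\tfrac12$. $Q\mapsto[\mathbf{O}_Q]$ is a bijection onto circuit reversal classes, and the Bernardi action $\Gamma(\mathbf{v},Q)$ is the quasi-tree $Q'$ with $[\mathbf{O}_{Q'}]=\mathbf{v}\cdot[\mathbf{O}_Q]$; it does not depend on $e_0$. The map $\varphi$ respects $\sim_J$ and induces a group isomorphism $\bar\varphi$. -}

module Defs where

open import Data.Nat using (ℕ; zero; suc; _<ᵇ_; _*_)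
open import Data.Bool using (Bool; true; false; not; if_then_else_; _∧_)
open import Data.Fin using (Fin; zero; suc)
import Data.Fin as Fin
open import Data.Integer using (ℤ; +_; _+_; _-_; -_)
open import Data.Product using (Σ; _×_; _,_; proj₁; proj₂; ∃; ∃-syntax)
open import Data.Product.Properties using (≡-dec)
import Data.Bool.Properties as BoolP
open import Data.Sum using (_⊎_)
open import Relation.Nullary using (¬_; Dec; yes; no)
open import Relation.Nullary.Decidable using (⌊_⌋)
open import Relation.Binary.PropositionalEquality using (_≡_; _≢_)
open import Relation.Binary.Construct.Closure.ReflexiveTransitive using (Star)
open import Relation.Binary.Construct.Closure.Equivalence using (EqClosure)

-- Darts.  Edges are Fin m.  The dart (e , false) is the end of e at its
-- tail, (e , true) the end of e at its head (w.r.t. the reference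
-- orientation).

Dart : ℕ → Set
Dart m = Fin m × Bool

edgeOf : ∀ {m} → Dart m → Fin m
edgeOf = proj₁

sideOf : ∀ {m} → Dart m → Bool
sideOf = proj₂

α : ∀ {m} → Dart m → Dart m
α (e , b) = (e , not b)

_≟D_ : ∀ {m} (d d' : Dart m) → Dec (d ≡ d')
_≟D_ = ≡-dec Fin._≟_ BoolP._≟_

iter : ∀ {A : Set} → (A → A) → ℕ → A → A
iter f zero x = x
iter f (suc k) x = f (iter f k x)

-- A connected ribbon graph (combinatorial map) with m edges: σ is the
-- rotation, sending an end of an edge at a vertex v to the next end at v
-- in the positive cyclic order around v.
record RibbonGraph : Set where
  field
    m : ℕ
    σ : Dart m → Dart m
    σ⁻ : Dart m → Dart m
    σ⁻σ : ∀ d → σ⁻ (σ d) ≡ d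
    σσ⁻ : ∀ d → σ (σ⁻ d) ≡ d
    connected : ∀ (d d' : Dart m) →
      Star (λ x y → (y ≡ σ x) ⊎ (y ≡ α x)) d d'

open RibbonGraph public

module _ (G : RibbonGraph) where

  private
    M = m G
    D = Dart M
    s = σ G

  Subgraph : Set
  Subgraph = Fin M → Bool

  -- The corner following end d at its vertex is the corner between d and
  -- σ d.  τ Q sends a corner to the next corner met by the boundary of
  -- the neighbourhood of Q (following edge σ d if it lies in Q).
  -- Read on the medial digraph (arc d : v_{edge d} → v_{edge (σ d)}),
  -- τ Q d is the arc that the tour E_Q takes after arc d.
  τ : Subgraph → D → D
  τ Q d = if Q (edgeOf (s d)) then α (s d) else s d

  -- one boundary component  ⇔  τ Q is a single cycle on the corners
  QuasiTree : Subgraph → Set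
  QuasiTree Q = ∀ (d d' : D) → ∃[ k ] (iter (τ Q) k d ≡ d')

  search : (ℕ → D) → D → ℕ → ℕ → ℕ
  search g a i zero = i
  search g a i (suc n) = if ⌊ g i ≟D a ⌋ then i else search g a (suc i) n

  pos : (ℕ → D) → D → ℕ
  pos g a = search g a 0 (2 * M)

  -- A rotor configuration chooses an out-arc of each node v_e; the
  -- out-arcs of v_e are the darts (e , false) = med⁺(e), (e , true) = med⁻(e).
  Rotor : Set
  Rotor = Fin M → Bool

  Chips : Set
  Chips = Fin M → ℤ

  [_≟_]ℤ : Fin M → Fin M → ℤ
  [ i ≟ j ]ℤ = if ⌊ i Fin.≟ j ⌋ then + 1 else + 0

  -- rotor configuration A_{a}(E) ∪ {a}: tour E (given by its successor
  -- map on arcs) started with arc a; at the tail of a the rotor is a,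
  -- at every other node the last traversed out-arc.
  tourRotor : (D → D) → D → Rotor
  tourRotor E a e =
    if ⌊ e Fin.≟ edgeOf a ⌋ then sideOf a
    else (pos seq (e , false) <ᵇ pos seq (e , true))
    where
      seq : ℕ → D
      seq k = iter E k a

  Routing : (Chips × Rotor) → (Chips × Rotor) → Set
  Routing (x , ρ) (y , ρ') = ∃[ e ]
    ((∀ n → ρ' n ≡ (if ⌊ n Fin.≟ e ⌋ then not (ρ e) else ρ n)) ×
     (∀ n → y n ≡ (x n - [ n ≟ e ]ℤ) + [ n ≟ edgeOf (s (e , not (ρ e))) ]ℤ))

  _≈CR_ : (Chips × Rotor) → (Chips × Rotor) → Set
  (x , ρ) ≈CR (y , ρ') = (∀ n → x n ≡ y n) × (∀ n → ρ n ≡ ρ' n)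

  Reach : (Chips × Rotor) → (Chips × Rotor) → Set
  Reach p q = ∃[ p' ] (Star Routing p p' × p' ≈CR q)

  Σℤ : (n : ℕ) → (Fin n → ℤ) → ℤ
  Σℤ zero f = + 0
  Σℤ (suc n) f = f zero + Σℤ n (λ i → f (suc i))

  -- φ(1_e) = - χ_{med⁺(e)} ; med⁺(e) is the arc (e , false) from v_e to
  -- v_{edge σ(e,false)}.
  φ : (Fin M → ℤ) → Chips
  φ v n = v n - Σℤ M (λ e → if ⌊ edgeOf (s (e , false)) Fin.≟ n ⌋ then v e else + 0)

  data Tag : Set where
    none primal dual : Tag

  -- C e = primal : e ∈ C ; C e = dual : e* ∈ C ; none : neither.
  CycleSet : Set
  CycleSet = Fin M → Tag

  -- The faces of G ∪ G* are the corner cells, indexed by darts d (corner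
  -- between d and σ d).  Cell d meets cell σ d across the half of
  -- edge (σ d) at that vertex, and cell α (σ d) across a half of (edge σ d)*.
  CellAdj : CycleSet → D → D → Set
  CellAdj C c c' =
    ((c' ≡ s c) × (C (edgeOf (s c)) ≢ primal)) ⊎
    ((c' ≡ α (s c)) × (C (edgeOf (s c)) ≢ dual))

  -- same component of Σ ∖ C
  Conn : CycleSet → D → D → Set
  Conn C = EqClosure (CellAdj C)

  TwoComponents : CycleSet → Set
  TwoComponents C = ∃[ c₁ ] ∃[ c₂ ]
    (¬ Conn C c₁ c₂ × (∀ c → Conn C c c₁ ⊎ Conn C c c₂))

  _⊑_ : CycleSet → CycleSet → Set
  C' ⊑ C = ∀ e → (C' e ≡ none) ⊎ (C' e ≡ C e)

  IsCycle : CycleSet → Set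
  IsCycle C = TwoComponents C ×
    (∀ C' → C' ⊑ C → TwoComponents C' → ∀ e → C' e ≡ C e)

  Ind : CycleSet → D → D → ℤ → Set
  Ind C c c' k = (Conn C c c' × k ≡ + 1) ⊎ (¬ Conn C c c' × k ≡ + 0)

  -- z = π(∂D) for D the component of Σ ∖ C containing cell c:
  -- for e or e* in C the region on the left of e (resp. of e*) contains
  -- cell (e , false), the region on the right contains cell (e , true).
  SignedCyclePi : CycleSet → D → (Fin M → ℤ) → Set
  SignedCyclePi C c z = ∀ e →
    (C e ≡ none × z e ≡ + 0) ⊎
    (C e ≢ none × ∃[ k₁ ] ∃[ k₂ ]
       (Ind C c (e , false) k₁ × Ind C c (e , true) k₂ × z e ≡ k₁ - k₂))

  JStep : (Fin M → ℤ) → (Fin M → ℤ) → Set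
  JStep x y = ∃[ C ] ∃[ c ] ∃[ z ]
    (IsCycle C × SignedCyclePi C c z × (∀ e → y e ≡ x e + z e))

  _∼J_ : (Fin M → ℤ) → (Fin M → ℤ) → Set
  x₁ ∼J x₂ = ∃[ y ] (EqClosure JStep x₁ y × (∀ e → y e ≡ x₂ e))

  -- Bernardi orientations.  Orientation O : Fin M → Bool, true ↔ +1/2.

  -- Half-edges are labelled by darts: label (e , b) is primal^{±}(e) if
  -- e ∉ Q and dual^{±}(e) if e ∈ Q, with b = true ↔ +, false ↔ −.
  -- crossNext Q l is the label of the next half-edge crossed by E_Q.
  crossNext : Subgraph → D → D
  crossNext Q l = s (if Q (edgeOf l) then α l else l)

  bernardi : Fin M → Subgraph → Fin M → Bool
  bernardi e₀ Q e =
    if Q e then (pos seq (e , false) <ᵇ pos seq (e , true))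
           else (pos seq (e , true) <ᵇ pos seq (e , false))
    where
      -- start: primal⁻(e₀) = label (e₀,false) if e₀ ∉ Q,
      --        dual⁺(e₀)   = label (e₀,true)  if e₀ ∈ Q
      seq : ℕ → D
      seq k = iter (crossNext Q) k (e₀ , Q e₀)

  orDiff : Bool → Bool → ℤ
  orDiff true false = + 1
  orDiff false true = - (+ 1)
  orDiff _ _ = + 0

  -- [O₂] = v · [O₁]  ⇔  v + O₁ ∼_J O₂  ⇔  v + (O₁ - O₂) ∼_J 0
  ActsTo : (Fin M → ℤ) → (Fin M → Bool) → (Fin M → Bool) → Set
  ActsTo v O₁ O₂ = (λ e → v e + orDiff (O₁ e) (O₂ e)) ∼J (λ _ → + 0)

module Submission where

-- Encode a chip-and-rotor configuration (x , ρ) of G⋈ by its charge x − φ(ρ), a rotor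
-- pointing along med⁻(e) counting as 1ₑ.  A routing changes the charge by a firing, and
-- conversely configurations whose charges differ by a firing are linked by routings: routing
-- twice at a node fires it, and firing all nodes changes nothing, so negative firings are
-- available too.  Moving the start of an Eulerian tour one arc forward is a single routing,
-- so the rotor configurations A_a(E) ∪ {a} of one tour for different start arcs a agree up to
-- routings once a chip at the head of a is accounted for.  Started at (e₀ , false), the tour
-- E_Q traverses the arcs in the same order as it crosses half-edges in Bernardi's numbering,
-- so the Bernardi orientation O_Q is the complement of the rotor configuration off e₀.
-- Finally φ maps the projection of the signed boundary of a region D to the firing of the
-- cells of D, so v + O_Q − O_Q' ∼_J 0 becomes a statement about charges.

open import Defs
open import Data.Nat as ℕ using (ℕ; zero; suc; _<ᵇ_; z≤n; s≤s; _≤_; _<_; _∸_; z<s; s<s)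
import Data.Nat.Properties as ℕP
open import Data.Bool using (Bool; true; false; not; if_then_else_)
import Data.Bool as Bool
import Data.Bool.Properties as BoolP
open import Data.Fin as Fin using (Fin; zero; suc; toℕ; _↑ˡ_; _↑ʳ_; splitAt)
import Data.Fin.Properties as FinP
open import Data.Integer using (ℤ; +_; _+_; _-_; -_; -[1+_])
import Data.Integer.Properties as ℤP
open import Data.Integer.Tactic.RingSolver using (solve-∀)
open import Data.Product using (∃-syntax; _×_; _,_; proj₁; proj₂)
open import Data.Sum using (_⊎_; inj₁; inj₂; [_,_]′)
open import Data.List using (List; []; _∷_; allFin)
open import Data.List.Membership.Propositional using (_∈_)
open import Data.List.Membership.Propositional.Properties using (∈-allFin)
open import Data.List.Relation.Unary.Any using (here; there)
open import Relation.Nullary using (¬_; Dec; yes; no; contradiction)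
open import Relation.Nullary.Decidable using (⌊_⌋; dec-true; dec-false)
open import Relation.Binary.PropositionalEquality
open import Relation.Binary.Definitions using (tri<; tri≈; tri>)
open import Relation.Binary.Construct.Closure.ReflexiveTransitive using (Star; ε; _◅_; _◅◅_)
open import Relation.Binary.Construct.Closure.Symmetric using (fwd; bwd)
import Relation.Binary.Construct.Closure.Equivalence as EqClosure

if-yes : ∀ {p} {P : Set p} {B : Set} {x y : B} (p? : Dec P) → P → (if ⌊ p? ⌋ then x else y) ≡ x
if-yes (yes _) _ = refl
if-yes (no ¬p) p = contradiction p ¬p

if-no : ∀ {p} {P : Set p} {B : Set} {x y : B} (p? : Dec P) → ¬ P → (if ⌊ p? ⌋ then x else y) ≡ y
if-no (yes p) ¬p = contradiction p ¬p
if-no (no _) _ = refl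

⌊≟⌋-sym : ∀ {n} (i j : Fin n) → ⌊ i Fin.≟ j ⌋ ≡ ⌊ j Fin.≟ i ⌋
⌊≟⌋-sym i j with i Fin.≟ j | j Fin.≟ i
... | yes _ | yes _ = refl
... | no _  | no _  = refl
... | yes p | no q  = contradiction (sym p) q
... | no p  | yes q = contradiction (sym q) p

toℤ : Bool → ℤ
toℤ c = if c then + 1 else + 0

cong₃ : ∀ {A B C D : Set} (f : A → B → C → D) {a a' b b' c c'} →
        a ≡ a' → b ≡ b' → c ≡ c' → f a b c ≡ f a' b' c'
cong₃ f refl refl refl = refl

iter-suc : ∀ {A : Set} (f : A → A) k x → iter f k (f x) ≡ iter f (suc k) x
iter-suc f zero x = refl
iter-suc f (suc k) x = cong f (iter-suc f k x)

iter-+ : ∀ {A : Set} (f : A → A) m n x → iter f (m ℕ.+ n) x ≡ iter f m (iter f n x)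
iter-+ f zero n x = refl
iter-+ f (suc m) n x = cong f (iter-+ f m n x)

<ᵇ-true : ∀ {m n} → m < n → (m <ᵇ n) ≡ true
<ᵇ-true {m} {n} = dec-true (m ℕ.<? n)

<ᵇ-false : ∀ {m n} → n ≤ m → (m <ᵇ n) ≡ false
<ᵇ-false {m} {n} n≤m = dec-false (m ℕ.<? n) (ℕP.≤⇒≯ n≤m)

<ᵇ-flip : ∀ {m n} → m ≢ n → (n <ᵇ m) ≡ not (m <ᵇ n)
<ᵇ-flip {m} {n} m≢n with ℕP.<-cmp m n
... | tri< m<n _ _ = trans (<ᵇ-false (ℕP.<⇒≤ m<n)) (cong not (sym (<ᵇ-true m<n)))
... | tri≈ _ m≡n _ = contradiction m≡n m≢n
... | tri> _ _ n<m = trans (<ᵇ-true n<m) (cong not (sym (<ᵇ-false (ℕP.<⇒≤ n<m))))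

1<2*size : ∀ {k} → Fin k → 1 < 2 ℕ.* k
1<2*size {suc k} _ = s≤s (ℕP.≤-trans (s≤s z≤n) (ℕP.m≤n+m (suc (k ℕ.+ 0)) k))

α≢ : ∀ {n} (d : Dart n) → α d ≢ d
α≢ (e , false) ()
α≢ (e , true) ()

⌊≟⌋-suc : ∀ {n} (i j : Fin n) → ⌊ suc i Fin.≟ suc j ⌋ ≡ ⌊ i Fin.≟ j ⌋
⌊≟⌋-suc i j with i Fin.≟ j
... | yes _ = refl
... | no _ = refl

isLeft : ∀ {A B : Set} → A ⊎ B → Bool
isLeft (inj₁ _) = true
isLeft (inj₂ _) = false

edge≡ : ∀ {m} {t : Dart m} {n} → edgeOf t ≡ n → t ≡ (n , false) ⊎ t ≡ (n , true)
edge≡ {t = _ , false} refl = inj₁ refl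
edge≡ {t = _ , true} refl = inj₂ refl

if-+ : ∀ (c : Bool) a b → (if c then a + b else + 0) ≡ (if c then a else + 0) + (if c then b else + 0)
if-+ true a b = refl
if-+ false a b = refl

if-neg : ∀ (c : Bool) a → (if c then - a else + 0) ≡ - (if c then a else + 0)
if-neg true a = refl
if-neg false a = refl

if-0 : ∀ (c : Bool) → (if c then + 0 else + 0) ≡ + 0
if-0 true = refl
if-0 false = refl

interchange : ∀ a b c d → (a + b) + (c + d) ≡ (a + c) + (b + d)
interchange = solve-∀

telescope : ∀ a b c → a - c ≡ (a - b) + (b - c)
telescope = solve-∀

module Medial (G : RibbonGraph) where

  M : ℕ
  M = m G

  D : Set
  D = Dart M

  Σℤ-cong : ∀ n {f g : Fin n → ℤ} → f ≗ g → Σℤ G n f ≡ Σℤ G n g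
  Σℤ-cong zero eq = refl
  Σℤ-cong (suc n) eq = cong₂ _+_ (eq zero) (Σℤ-cong n (λ i → eq (suc i)))

  Σℤ-zero : ∀ n → Σℤ G n (λ _ → + 0) ≡ + 0
  Σℤ-zero zero = refl
  Σℤ-zero (suc n) = cong (λ s → + 0 + s) (Σℤ-zero n)

  Σℤ-+ : ∀ n (f g : Fin n → ℤ) → Σℤ G n (λ i → f i + g i) ≡ Σℤ G n f + Σℤ G n g
  Σℤ-+ zero f g = refl
  Σℤ-+ (suc n) f g = trans (cong (λ s → (f zero + g zero) + s) (Σℤ-+ n (λ i → f (suc i)) (λ i → g (suc i))))
                           (interchange (f zero) (g zero) _ _)

  Σℤ-neg : ∀ n (f : Fin n → ℤ) → Σℤ G n (λ i → - f i) ≡ - Σℤ G n f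
  Σℤ-neg zero f = refl
  Σℤ-neg (suc n) f = trans (cong (λ s → - f zero + s) (Σℤ-neg n (λ i → f (suc i))))
                           (sym (ℤP.neg-distrib-+ (f zero) _))

  Σℤ-single : ∀ n (j : Fin n) (f : Fin n → ℤ) →
              Σℤ G n (λ i → if ⌊ i Fin.≟ j ⌋ then f i else + 0) ≡ f j
  Σℤ-single (suc n) zero f = trans (cong (λ s → f zero + s) (Σℤ-zero n)) (ℤP.+-identityʳ (f zero))
  Σℤ-single (suc n) (suc j) f = begin
    + 0 + Σℤ G n (λ i → if ⌊ suc i Fin.≟ suc j ⌋ then f (suc i) else + 0)
      ≡⟨ ℤP.+-identityˡ _ ⟩
    Σℤ G n (λ i → if ⌊ suc i Fin.≟ suc j ⌋ then f (suc i) else + 0)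
      ≡⟨ Σℤ-cong n (λ i → cong (if_then f (suc i) else + 0) (⌊≟⌋-suc i j)) ⟩
    Σℤ G n (λ i → if ⌊ i Fin.≟ j ⌋ then f (suc i) else + 0)
      ≡⟨ Σℤ-single n j (λ i → f (suc i)) ⟩
    f (suc j) ∎
    where open ≡-Reasoning

  Σℤ-delete : ∀ n (j : Fin n) (f : Fin n → ℤ) →
               Σℤ G n (λ i → if ⌊ i Fin.≟ j ⌋ then + 0 else f i) ≡ Σℤ G n f - f j
  Σℤ-delete n j f = begin
    Σℤ G n (λ i → if ⌊ i Fin.≟ j ⌋ then + 0 else f i)
      ≡⟨ Σℤ-cong n (λ i → split ⌊ i Fin.≟ j ⌋ (f i)) ⟩
    Σℤ G n (λ i → f i + - (if ⌊ i Fin.≟ j ⌋ then f i else + 0))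
      ≡⟨ Σℤ-+ n f _ ⟩
    Σℤ G n f + Σℤ G n (λ i → - (if ⌊ i Fin.≟ j ⌋ then f i else + 0))
      ≡⟨ cong (λ s → Σℤ G n f + s) (trans (Σℤ-neg n _) (cong -_ (Σℤ-single n j f))) ⟩
    Σℤ G n f - f j ∎
    where
    open ≡-Reasoning
    split : ∀ c x → (if c then + 0 else x) ≡ x + - (if c then x else + 0)
    split true x = sym (ℤP.+-inverseʳ x)
    split false x = sym (ℤP.+-identityʳ x)

  inflow : Bool → Fin M → Chips G → ℤ
  inflow b n k = Σℤ G M (λ e → if ⌊ edgeOf (σ G (e , b)) Fin.≟ n ⌋ then k e else + 0)

  fire : Chips G → Chips G
  fire k n = (inflow false n k + inflow true n k) - (k n + k n)

  IsFiring : Chips G → Set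
  IsFiring u = ∃[ k ] u ≗ fire k

  inflow-cong : ∀ b n {f g} → f ≗ g → inflow b n f ≡ inflow b n g
  inflow-cong b n eq = Σℤ-cong M (λ e → cong (if ⌊ edgeOf (σ G (e , b)) Fin.≟ n ⌋ then_else + 0) (eq e))

  inflow-zero : ∀ b n → inflow b n (λ _ → + 0) ≡ + 0
  inflow-zero b n = trans (Σℤ-cong M (λ e → if-0 ⌊ edgeOf (σ G (e , b)) Fin.≟ n ⌋)) (Σℤ-zero M)

  inflow-+ : ∀ b n f g → inflow b n (λ e → f e + g e) ≡ inflow b n f + inflow b n g
  inflow-+ b n f g = trans (Σℤ-cong M (λ e → if-+ ⌊ edgeOf (σ G (e , b)) Fin.≟ n ⌋ (f e) (g e))) (Σℤ-+ M _ _)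

  inflow-neg : ∀ b n f → inflow b n (λ e → - f e) ≡ - inflow b n f
  inflow-neg b n f = trans (Σℤ-cong M (λ e → if-neg ⌊ edgeOf (σ G (e , b)) Fin.≟ n ⌋ (f e))) (Σℤ-neg M _)

  private
    ≡σ⁻⇒σ≡ : ∀ {d t} → d ≡ σ⁻ G t → σ G d ≡ t
    ≡σ⁻⇒σ≡ {t = t} refl = σσ⁻ G t

    σ≡⇒≡σ⁻ : ∀ {d t} → σ G d ≡ t → d ≡ σ⁻ G t
    σ≡⇒≡σ⁻ {d} refl = sym (σ⁻σ G d)

  inArc-split : ∀ (x : ℤ) n d →
    (if ⌊ edgeOf (σ G d) Fin.≟ n ⌋ then x else + 0) ≡
    (if ⌊ d ≟D σ⁻ G (n , false) ⌋ then x else + 0) + (if ⌊ d ≟D σ⁻ G (n , true) ⌋ then x else + 0)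
  inArc-split x n d with d ≟D σ⁻ G (n , false) | d ≟D σ⁻ G (n , true)
  ... | yes p | yes q = contradiction (trans (sym (≡σ⁻⇒σ≡ p)) (≡σ⁻⇒σ≡ q)) λ ()
  ... | yes p | no _ = trans (if-yes (edgeOf (σ G d) Fin.≟ n) (cong edgeOf (≡σ⁻⇒σ≡ p))) (sym (ℤP.+-identityʳ x))
  ... | no _ | yes q = trans (if-yes (edgeOf (σ G d) Fin.≟ n) (cong edgeOf (≡σ⁻⇒σ≡ q))) (sym (ℤP.+-identityˡ x))
  ... | no p | no q = if-no (edgeOf (σ G d) Fin.≟ n) λ e → [ (λ r → p (σ≡⇒≡σ⁻ r)) , (λ r → q (σ≡⇒≡σ⁻ r)) ]′ (edge≡ e)

  arc-single : ∀ (h : D → ℤ) (t : D) e →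
    (if ⌊ (e , false) ≟D t ⌋ then h (e , false) else + 0) + (if ⌊ (e , true) ≟D t ⌋ then h (e , true) else + 0)
    ≡ (if ⌊ e Fin.≟ edgeOf t ⌋ then h t else + 0)
  arc-single h t e = split (e Fin.≟ edgeOf t)
    where
    split : Dec (e ≡ edgeOf t) →
      (if ⌊ (e , false) ≟D t ⌋ then h (e , false) else + 0) + (if ⌊ (e , true) ≟D t ⌋ then h (e , true) else + 0)
      ≡ (if ⌊ e Fin.≟ edgeOf t ⌋ then h t else + 0)
    split (no r) = trans (cong₂ _+_ (if-no ((e , false) ≟D t) (λ p → r (cong edgeOf p)))
                                    (if-no ((e , true) ≟D t) (λ p → r (cong edgeOf p))))
                         (sym (if-no (e Fin.≟ edgeOf t) r))
    split (yes r) with edge≡ {t = t} (sym r)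
    ... | inj₁ s = trans (cong₂ _+_ (if-yes ((e , false) ≟D t) (sym s))
                                    (if-no ((e , true) ≟D t) (λ p → contradiction (trans p s) λ ())))
                         (trans (ℤP.+-identityʳ _) (trans (cong h (sym s)) (sym (if-yes (e Fin.≟ edgeOf t) r))))
    ... | inj₂ s = trans (cong₂ _+_ (if-no ((e , false) ≟D t) (λ p → contradiction (trans p s) λ ()))
                                    (if-yes ((e , true) ≟D t) (sym s)))
                         (trans (ℤP.+-identityˡ _) (trans (cong h (sym s)) (sym (if-yes (e Fin.≟ edgeOf t) r))))

  inflow-arcs : ∀ (h : D → ℤ) n →
    inflow false n (λ e → h (e , false)) + inflow true n (λ e → h (e , true))
    ≡ h (σ⁻ G (n , false)) + h (σ⁻ G (n , true))
  inflow-arcs h n = begin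
    inflow false n (λ e → h (e , false)) + inflow true n (λ e → h (e , true))
      ≡⟨ cong₂ _+_ (trans (Σℤ-cong M (λ e → inArc-split _ n (e , false))) (Σℤ-+ M _ _))
                   (trans (Σℤ-cong M (λ e → inArc-split _ n (e , true))) (Σℤ-+ M _ _)) ⟩
    (Σℤ G M (atF t₁) + Σℤ G M (atF t₂)) + (Σℤ G M (atT t₁) + Σℤ G M (atT t₂))
      ≡⟨ interchange (Σℤ G M (atF t₁)) (Σℤ G M (atF t₂)) (Σℤ G M (atT t₁)) (Σℤ G M (atT t₂)) ⟩
    (Σℤ G M (atF t₁) + Σℤ G M (atT t₁)) + (Σℤ G M (atF t₂) + Σℤ G M (atT t₂))
      ≡⟨ cong₂ _+_ (total t₁) (total t₂) ⟩
    h t₁ + h t₂ ∎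
    where
    open ≡-Reasoning
    t₁ t₂ : D
    t₁ = σ⁻ G (n , false)
    t₂ = σ⁻ G (n , true)
    atF atT : D → Fin M → ℤ
    atF t e = if ⌊ (e , false) ≟D t ⌋ then h (e , false) else + 0
    atT t e = if ⌊ (e , true) ≟D t ⌋ then h (e , true) else + 0
    total : ∀ t → Σℤ G M (atF t) + Σℤ G M (atT t) ≡ h t
    total t = trans (sym (Σℤ-+ M (atF t) (atT t)))
                    (trans (Σℤ-cong M (arc-single h t)) (Σℤ-single M (edgeOf t) (λ _ → h t)))

  fire-cong : ∀ {k₁ k₂} → k₁ ≗ k₂ → fire k₁ ≗ fire k₂
  fire-cong {k₁} {k₂} eq n =
    cong₃ (λ a b c → (a + b) - (c + c)) (inflow-cong false n eq) (inflow-cong true n eq) (eq n)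

  fire-zero : fire (λ _ → + 0) ≗ (λ _ → + 0)
  fire-zero n = cong₂ (λ a b → (a + b) - + 0) (inflow-zero false n) (inflow-zero true n)

  fire-+ : ∀ k₁ k₂ → fire (λ e → k₁ e + k₂ e) ≗ (λ n → fire k₁ n + fire k₂ n)
  fire-+ k₁ k₂ n =
    trans (cong₂ (λ a b → (a + b) - ((k₁ n + k₂ n) + (k₁ n + k₂ n))) (inflow-+ false n k₁ k₂) (inflow-+ true n k₁ k₂))
          (regroup (inflow false n k₁) (inflow false n k₂) (inflow true n k₁) (inflow true n k₂) (k₁ n) (k₂ n))
    where
    regroup : ∀ a b c d x y → ((a + b) + (c + d)) - ((x + y) + (x + y)) ≡ ((a + c) - (x + x)) + ((b + d) - (y + y))
    regroup = solve-∀

  fire-neg : ∀ k → fire (λ e → - k e) ≗ (λ n → - fire k n)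
  fire-neg k n =
    trans (cong₂ (λ a b → (a + b) - (- k n + - k n)) (inflow-neg false n k) (inflow-neg true n k))
          (regroup (inflow false n k) (inflow true n k) (k n))
    where
    regroup : ∀ a c x → ((- a) + (- c)) - ((- x) + (- x)) ≡ - ((a + c) - (x + x))
    regroup = solve-∀

  fire-ones : fire (λ _ → + 1) ≗ (λ _ → + 0)
  fire-ones n = cong (λ s → s - (+ 1 + + 1)) (inflow-arcs (λ _ → + 1) n)

  single : ℤ → Fin M → Chips G
  single c e n = if ⌊ n Fin.≟ e ⌋ then c else + 0

  inflow-single : ∀ b n c e → inflow b n (single c e) ≡ single c (edgeOf (σ G (e , b))) n
  inflow-single b n c e =
    trans (Σℤ-cong M (λ i → swap ⌊ edgeOf (σ G (i , b)) Fin.≟ n ⌋ ⌊ i Fin.≟ e ⌋))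
          (trans (Σℤ-single M e (λ i → if ⌊ edgeOf (σ G (i , b)) Fin.≟ n ⌋ then c else + 0))
                 (cong (if_then c else + 0) (⌊≟⌋-sym (edgeOf (σ G (e , b))) n)))
    where
    swap : ∀ p q → (if p then (if q then c else + 0) else + 0) ≡ (if q then (if p then c else + 0) else + 0)
    swap true true = refl
    swap true false = refl
    swap false true = refl
    swap false false = refl

  fire-single : ∀ c e n → fire (single c e) n ≡
    (single c (edgeOf (σ G (e , false))) n + single c (edgeOf (σ G (e , true))) n) - (single c e n + single c e n)
  fire-single c e n = cong₂ (λ a b → (a + b) - (single c e n + single c e n))
                            (inflow-single false n c e) (inflow-single true n c e)

  φ-cong : ∀ {f g} → f ≗ g → φ G f ≗ φ G g
  φ-cong eq n = cong₂ _-_ (eq n) (inflow-cong false n eq)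

  φ-+ : ∀ f g → φ G (λ e → f e + g e) ≗ (λ n → φ G f n + φ G g n)
  φ-+ f g n = trans (cong (λ s → (f n + g n) - s) (inflow-+ false n f g))
                    (regroup (f n) (g n) (inflow false n f) (inflow false n g))
    where
    regroup : ∀ a b c d → (a + b) - (c + d) ≡ (a - c) + (b - d)
    regroup = solve-∀

  φ-neg : ∀ f → φ G (λ e → - f e) ≗ (λ n → - φ G f n)
  φ-neg f n = trans (cong (λ s → - f n - s) (inflow-neg false n f)) (regroup (f n) (inflow false n f))
    where
    regroup : ∀ a c → (- a) - (- c) ≡ - (a - c)
    regroup = solve-∀

  φ-single : ∀ c e n → φ G (single c e) n ≡ single c e n - single c (edgeOf (σ G (e , false))) n
  φ-single c e n = cong (λ s → single c e n - s) (inflow-single false n c e)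

  IsFiring-resp : ∀ {u w} → IsFiring u → w ≗ u → IsFiring w
  IsFiring-resp (k , u≗) w≗ = k , λ n → trans (w≗ n) (u≗ n)

  IsFiring-zero : ∀ {u} → u ≗ (λ _ → + 0) → IsFiring u
  IsFiring-zero u≗0 = (λ _ → + 0) , λ n → trans (u≗0 n) (sym (fire-zero n))

  IsFiring-add : ∀ {u w t} → IsFiring u → IsFiring w → t ≗ (λ n → u n + w n) → IsFiring t
  IsFiring-add (k₁ , u≗) (k₂ , w≗) t≗ =
    (λ e → k₁ e + k₂ e) , λ n → trans (t≗ n) (trans (cong₂ _+_ (u≗ n) (w≗ n)) (sym (fire-+ k₁ k₂ n)))

  IsFiring-neg : ∀ {u t} → IsFiring u → t ≗ (λ n → - u n) → IsFiring t
  IsFiring-neg (k , u≗) t≗ = (λ e → - k e) , λ n → trans (t≗ n) (trans (cong -_ (u≗ n)) (sym (fire-neg k n)))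

  Config : Set
  Config = Chips G × Rotor G

  private
    _≈_ : Config → Config → Set
    _≈_ = _≈CR_ G

  indicator : Rotor G → Chips G
  indicator ρ e = toℤ (ρ e)

  -- The class of a configuration in S(G⋈); routings change it only by firings.
  charge : Config → Chips G
  charge (x , ρ) n = x n - φ G (indicator ρ) n

  charge-cong : ∀ {p q} → p ≈ q → charge p ≗ charge q
  charge-cong {x , ρ} {y , ρ'} (x≗y , ρ≗ρ') n = cong₂ _-_ (x≗y n) (φ-cong (λ e → cong toℤ (ρ≗ρ' e)) n)

  flipAt : Fin M → Rotor G → Rotor G
  flipAt e ρ n = if ⌊ n Fin.≟ e ⌋ then not (ρ e) else ρ n

  indicator-flipAt : ∀ e ρ → indicator (flipAt e ρ) ≗ (λ n → indicator ρ n + single (toℤ (not (ρ e)) - toℤ (ρ e)) e n)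
  indicator-flipAt e ρ n with n Fin.≟ e
  ... | yes refl = add-diff (toℤ (not (ρ n))) (toℤ (ρ n))
    where
    add-diff : ∀ a b → a ≡ b + (a - b)
    add-diff = solve-∀
  ... | no _ = sym (ℤP.+-identityʳ _)

  single-neg₁ : ∀ e n → single (+ 0 - + 1) e n ≡ - single (+ 1) e n
  single-neg₁ e n with ⌊ n Fin.≟ e ⌋
  ... | true = refl
  ... | false = refl

  φ-indicator-flipAt : ∀ e ρ n → φ G (indicator (flipAt e ρ)) n ≡
    φ G (indicator ρ) n + (single (toℤ (not (ρ e)) - toℤ (ρ e)) e n
                           - single (toℤ (not (ρ e)) - toℤ (ρ e)) (edgeOf (σ G (e , false))) n)
  φ-indicator-flipAt e ρ n = begin
    φ G (indicator (flipAt e ρ)) n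
      ≡⟨ φ-cong (indicator-flipAt e ρ) n ⟩
    φ G (λ m → indicator ρ m + single s e m) n
      ≡⟨ φ-+ (indicator ρ) (single s e) n ⟩
    φ G (indicator ρ) n + φ G (single s e) n
      ≡⟨ cong (λ w → φ G (indicator ρ) n + w) (φ-single s e n) ⟩
    φ G (indicator ρ) n + (single s e n - single s (edgeOf (σ G (e , false))) n) ∎
    where
    open ≡-Reasoning
    s : ℤ
    s = toℤ (not (ρ e)) - toℤ (ρ e)

  routing-charge : ∀ {p q} → Routing G p q → IsFiring (λ n → charge q n - charge p n)
  routing-charge {x , ρ} {y , ρ'} (e , ρ'≗ , y≗) = by-rotor (ρ e) refl
    where
    hd : Bool → Fin M
    hd b = edgeOf (σ G (e , b))
    φρ : Chips G
    φρ = φ G (indicator ρ)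
    a f t : Fin M → ℤ
    a = single (+ 1) e
    f = single (+ 1) (hd false)
    t = single (+ 1) (hd true)
    Δcharge : ∀ {r} → ρ e ≡ r → ∀ n → charge (y , ρ') n - charge (x , ρ) n ≡
      (((x n - a n) + single (+ 1) (hd (not r)) n)
        - (φρ n + (single (toℤ (not r) - toℤ r) e n - single (toℤ (not r) - toℤ r) (hd false) n)))
      - (x n - φρ n)
    Δcharge refl n = cong₂ (λ u w → (u - w) - (x n - φρ n)) (y≗ n)
                           (trans (φ-cong (λ m → cong toℤ (ρ'≗ m)) n) (φ-indicator-flipAt e ρ n))
    by-rotor : ∀ r → ρ e ≡ r → IsFiring (λ n → charge (y , ρ') n - charge (x , ρ) n)
    by-rotor true ρe = IsFiring-zero λ n →
      trans (Δcharge ρe n)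
            (trans (cong₂ (λ u w → (((x n - a n) + f n) - (φρ n + (u - w))) - (x n - φρ n))
                          (single-neg₁ e n) (single-neg₁ (hd false) n))
                   (cancel (x n) (φρ n) (a n) (f n)))
      where
      cancel : ∀ x φ a f → (((x - a) + f) - (φ + ((- a) - (- f)))) - (x - φ) ≡ + 0
      cancel = solve-∀
    by-rotor false ρe = single (+ 1) e , λ n →
      trans (Δcharge ρe n) (trans (collect (x n) (φρ n) (a n) (f n) (t n)) (sym (fire-single (+ 1) e n)))
      where
      collect : ∀ x φ a f t → (((x - a) + t) - (φ + (a - f))) - (x - φ) ≡ (f + t) - (a + a)
      collect = solve-∀

  star-charge : ∀ {p q} → Star (Routing G) p q → IsFiring (λ n → charge q n - charge p n)
  star-charge {p} ε = IsFiring-zero (λ n → ℤP.+-inverseʳ (charge p n))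
  star-charge {p} {q} (_◅_ {j = p'} r rs) =
    IsFiring-add (star-charge rs) (routing-charge {p} {p'} r) (λ n → telescope (charge q n) (charge p' n) (charge p n))

  Reach⇒IsFiring : ∀ {p q} → Reach G p q → IsFiring (λ n → charge q n - charge p n)
  Reach⇒IsFiring {p} (p' , rs , p'≈q) =
    IsFiring-resp (star-charge rs) (λ n → cong (λ c → c - charge p n) (sym (charge-cong p'≈q n)))

  ≈-refl : ∀ {p} → p ≈ p
  ≈-refl = (λ _ → refl) , (λ _ → refl)

  ≈-sym : ∀ {p q} → p ≈ q → q ≈ p
  ≈-sym (x≗y , ρ≗ρ') = (λ n → sym (x≗y n)) , (λ n → sym (ρ≗ρ' n))

  ≈-trans : ∀ {p q r} → p ≈ q → q ≈ r → p ≈ r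
  ≈-trans (x≗y , ρ≗ρ') (y≗z , ρ'≗ρ'') = (λ n → trans (x≗y n) (y≗z n)) , (λ n → trans (ρ≗ρ' n) (ρ'≗ρ'' n))

  Routing-resp : ∀ {p p' q} → p ≈ p' → Routing G p q → Routing G p' q
  Routing-resp (x≗x' , ρ≗ρ') (e , ρ''≗ , y≗) =
    e , (λ n → trans (ρ''≗ n) (cong₂ (λ r s → if ⌊ n Fin.≟ e ⌋ then not r else s) (ρ≗ρ' e) (ρ≗ρ' n))) ,
        (λ n → trans (y≗ n) (cong₂ (λ z r → (z - [_≟_]ℤ G n e) + [_≟_]ℤ G n (edgeOf (σ G (e , not r)))) (x≗x' n) (ρ≗ρ' e)))

  ≈⇒Reach : ∀ {p q} → p ≈ q → Reach G p q
  ≈⇒Reach {p} p≈q = p , ε , p≈q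

  Reach-trans : ∀ {p q r} → Reach G p q → Reach G q r → Reach G p r
  Reach-trans {p} (p' , rs , p'≈q) (q' , ε , q'≈r) = p' , rs , ≈-trans p'≈q q'≈r
  Reach-trans {p} (p' , rs , p'≈q) (q' , r ◅ rs' , q'≈r) = q' , rs ◅◅ (Routing-resp (≈-sym p'≈q) r ◅ rs') , q'≈r

  routeAt : Fin M → Config → Config
  routeAt e (x , ρ) = (λ n → (x n - [_≟_]ℤ G n e) + [_≟_]ℤ G n (edgeOf (σ G (e , not (ρ e))))) , flipAt e ρ

  routeAt-Reach : ∀ e p → Reach G p (routeAt e p)
  routeAt-Reach e p = routeAt e p , (e , (λ _ → refl) , (λ _ → refl)) ◅ ε , ≈-refl

  flipAt-here : ∀ e ρ → flipAt e ρ e ≡ not (ρ e)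
  flipAt-here e ρ = if-yes (e Fin.≟ e) refl

  flipAt-involutive : ∀ e ρ → flipAt e (flipAt e ρ) ≗ ρ
  flipAt-involutive e ρ n with n Fin.≟ e
  ... | yes refl = trans (cong not (flipAt-here n ρ)) (BoolP.not-involutive (ρ n))
  ... | no _ = refl

  FireReachable : Chips G → Set
  FireReachable k = ∀ x ρ → Reach G (x , ρ) ((λ n → x n + fire k n) , ρ)

  -- Routing twice at e sends one chip along each out-arc and restores the rotor.
  FireReachable-unit : ∀ e → FireReachable (single (+ 1) e)
  FireReachable-unit e x ρ =
    Reach-trans (routeAt-Reach e (x , ρ))
      (Reach-trans (routeAt-Reach e (routeAt e (x , ρ))) (≈⇒Reach (chips , flipAt-involutive e ρ)))
    where
    hd : Bool → Fin M
    hd b = edgeOf (σ G (e , b))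
    a : Fin M → ℤ
    a = single (+ 1) e
    both-heads : ∀ r n → single (+ 1) (hd (not r)) n + single (+ 1) (hd (not (not r))) n
                       ≡ single (+ 1) (hd false) n + single (+ 1) (hd true) n
    both-heads false n = ℤP.+-comm (single (+ 1) (hd true) n) (single (+ 1) (hd false) n)
    both-heads true n = refl
    regroup : ∀ x a h₁ h₂ → (((x - a) + h₁) - a) + h₂ ≡ x + ((h₁ + h₂) - (a + a))
    regroup = solve-∀
    chips : ∀ n → proj₁ (routeAt e (routeAt e (x , ρ))) n ≡ x n + fire (single (+ 1) e) n
    chips n = begin
      (((x n - a n) + single (+ 1) (hd (not (ρ e))) n) - a n) + single (+ 1) (hd (not (flipAt e ρ e))) n
        ≡⟨ cong (λ r → (((x n - a n) + single (+ 1) (hd (not (ρ e))) n) - a n) + single (+ 1) (hd (not r)) n)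
                (flipAt-here e ρ) ⟩
      (((x n - a n) + single (+ 1) (hd (not (ρ e))) n) - a n) + single (+ 1) (hd (not (not (ρ e)))) n
        ≡⟨ regroup (x n) (a n) _ _ ⟩
      x n + ((single (+ 1) (hd (not (ρ e))) n + single (+ 1) (hd (not (not (ρ e)))) n) - (a n + a n))
        ≡⟨ cong (λ h → x n + (h - (a n + a n))) (both-heads (ρ e) n) ⟩
      x n + ((single (+ 1) (hd false) n + single (+ 1) (hd true) n) - (a n + a n))
        ≡⟨ cong (λ h → x n + h) (sym (fire-single (+ 1) e n)) ⟩
      x n + fire (single (+ 1) e) n ∎
      where open ≡-Reasoning

  FireReachable-resp : ∀ {k k'} → fire k ≗ fire k' → FireReachable k → FireReachable k'
  FireReachable-resp k≗k' reach x ρ =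
    Reach-trans (reach x ρ) (≈⇒Reach ((λ n → cong (λ c → x n + c) (k≗k' n)) , (λ _ → refl)))

  FireReachable-zero : FireReachable (λ _ → + 0)
  FireReachable-zero x ρ =
    ≈⇒Reach ((λ n → sym (trans (cong (λ c → x n + c) (fire-zero n)) (ℤP.+-identityʳ (x n)))) , (λ _ → refl))

  FireReachable-+ : ∀ {k₁ k₂} → FireReachable k₁ → FireReachable k₂ → FireReachable (λ e → k₁ e + k₂ e)
  FireReachable-+ {k₁} {k₂} reach₁ reach₂ x ρ =
    Reach-trans (reach₁ x ρ) (Reach-trans (reach₂ _ ρ) (≈⇒Reach (chips , (λ _ → refl))))
    where
    chips : ∀ n → (x n + fire k₁ n) + fire k₂ n ≡ x n + fire (λ e → k₁ e + k₂ e) n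
    chips n = trans (ℤP.+-assoc (x n) _ _) (cong (λ c → x n + c) (sym (fire-+ k₁ k₂ n)))

  FireReachable-Σ : ∀ n (k : Fin n → Chips G) → (∀ i → FireReachable (k i)) →
                    FireReachable (λ e → Σℤ G n (λ i → k i e))
  FireReachable-Σ zero k reach = FireReachable-zero
  FireReachable-Σ (suc n) k reach =
    FireReachable-+ (reach zero) (FireReachable-Σ n (λ i → k (suc i)) (λ i → reach (suc i)))

  FireReachable-ℕ : ∀ c e → FireReachable (single (+ c) e)
  FireReachable-ℕ zero e = FireReachable-resp (fire-cong (λ n → sym (if-0 ⌊ n Fin.≟ e ⌋))) FireReachable-zero
  FireReachable-ℕ (suc c) e =
    FireReachable-resp (fire-cong (λ n → add (⌊ n Fin.≟ e ⌋))) (FireReachable-+ (FireReachable-unit e) (FireReachable-ℕ c e))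
    where
    add : ∀ b → (if b then + 1 else + 0) + (if b then + c else + 0) ≡ (if b then + suc c else + 0)
    add true = refl
    add false = refl

  -- Firing every node but e undoes one firing of e, as firing all nodes changes nothing.
  FireReachable-single₋₁ : ∀ e → FireReachable (single -[1+ 0 ] e)
  FireReachable-single₋₁ e = FireReachable-resp same-firing (FireReachable-Σ M others others-reach)
    where
    others : Fin M → Chips G
    others i n = if ⌊ i Fin.≟ e ⌋ then + 0 else single (+ 1) i n
    others-reach : ∀ i → FireReachable (others i)
    others-reach i with i Fin.≟ e
    ... | yes _ = FireReachable-zero
    ... | no _ = FireReachable-ℕ 1 i
    count : ∀ n → Σℤ G M (λ i → others i n) ≡ + 1 + - single (+ 1) e n
    count n = trans (Σℤ-delete M e (λ i → single (+ 1) i n))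
                    (cong (λ c → c - single (+ 1) e n)
                          (trans (Σℤ-cong M (λ i → cong (if_then + 1 else + 0) (⌊≟⌋-sym n i))) (Σℤ-single M n (λ _ → + 1))))
    same-firing : fire (λ n → Σℤ G M (λ i → others i n)) ≗ fire (single -[1+ 0 ] e)
    same-firing n = begin
      fire (λ n → Σℤ G M (λ i → others i n)) n
        ≡⟨ fire-cong count n ⟩
      fire (λ n → + 1 + - single (+ 1) e n) n
        ≡⟨ fire-+ (λ _ → + 1) (λ n → - single (+ 1) e n) n ⟩
      fire (λ _ → + 1) n + fire (λ n → - single (+ 1) e n) n
        ≡⟨ cong₂ _+_ (fire-ones n) (fire-cong (λ m → sym (single-neg₁ e m)) n) ⟩
      + 0 + fire (single -[1+ 0 ] e) n
        ≡⟨ ℤP.+-identityˡ _ ⟩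
      fire (single -[1+ 0 ] e) n ∎
      where open ≡-Reasoning

  FireReachable-negsuc : ∀ c e → FireReachable (single -[1+ c ] e)
  FireReachable-negsuc zero e = FireReachable-single₋₁ e
  FireReachable-negsuc (suc c) e =
    FireReachable-resp (fire-cong (λ n → add (⌊ n Fin.≟ e ⌋)))
                       (FireReachable-+ (FireReachable-single₋₁ e) (FireReachable-negsuc c e))
    where
    add : ∀ b → (if b then -[1+ 0 ] else + 0) + (if b then -[1+ c ] else + 0) ≡ (if b then -[1+ suc c ] else + 0)
    add true = refl
    add false = refl

  FireReachable-single : ∀ c e → FireReachable (single c e)
  FireReachable-single (+ c) e = FireReachable-ℕ c e
  FireReachable-single -[1+ c ] e = FireReachable-negsuc c e

  fire-reachable : ∀ k → FireReachable k
  fire-reachable k = FireReachable-resp (fire-cong decompose) (FireReachable-Σ M (λ i → single (k i) i) (λ i → FireReachable-single (k i) i))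
    where
    decompose : ∀ n → Σℤ G M (λ i → single (k i) i n) ≡ k n
    decompose n = trans (Σℤ-cong M (λ i → cong (if_then k i else + 0) (⌊≟⌋-sym n i))) (Σℤ-single M n k)

  align-rotor : ∀ (ρ' : Rotor G) (L : List (Fin M)) x ρ →
    ∃[ x' ] ∃[ ρ'' ] Reach G (x , ρ) (x' , ρ'') × (∀ n → n ∈ L → ρ'' n ≡ ρ' n)
  align-rotor ρ' [] x ρ = x , ρ , ≈⇒Reach ≈-refl , λ _ ()
  align-rotor ρ' (e ∷ L) x ρ with align-rotor ρ' L x ρ
  ... | x₁ , ρ₁ , reach₁ , agree with ρ₁ e Bool.≟ ρ' e
  ...   | yes same = x₁ , ρ₁ , reach₁ , agree′
    where
    agree′ : ∀ n → n ∈ e ∷ L → ρ₁ n ≡ ρ' n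
    agree′ n (here refl) = same
    agree′ n (there n∈L) = agree n n∈L
  ...   | no differ = proj₁ (routeAt e (x₁ , ρ₁)) , flipAt e ρ₁ , Reach-trans reach₁ (routeAt-Reach e (x₁ , ρ₁)) , agree′
    where
    flipped : not (ρ₁ e) ≡ ρ' e
    flipped = sym (BoolP.¬-not (≢-sym differ))
    agree′ : ∀ n → n ∈ e ∷ L → flipAt e ρ₁ n ≡ ρ' n
    agree′ n (here refl) = trans (flipAt-here n ρ₁) flipped
    agree′ n (there n∈L) with n Fin.≟ e
    ... | yes refl = flipped
    ... | no _ = agree n n∈L

  charge⇒Reach : ∀ {p q} → IsFiring (λ n → charge q n - charge p n) → Reach G p q
  charge⇒Reach {x , ρ} {y , ρ'} charges with align-rotor ρ' (allFin M) x ρ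
  ... | x₁ , ρ₁ , reach₁ , agree =
    finish (IsFiring-add charges (IsFiring-neg (Reach⇒IsFiring reach₁) (λ _ → refl)) chips-diff)
    where
    ρ₁≗ρ' : ρ₁ ≗ ρ'
    ρ₁≗ρ' n = agree n (∈-allFin n)
    difference : ∀ y x₁ φ c → y - x₁ ≡ ((y - φ) - c) + - ((x₁ - φ) - c)
    difference = solve-∀
    chips-diff : ∀ n → y n - x₁ n ≡ (charge (y , ρ') n - charge (x , ρ) n) + - (charge (x₁ , ρ₁) n - charge (x , ρ) n)
    chips-diff n = trans (difference (y n) (x₁ n) (φ G (indicator ρ') n) (charge (x , ρ) n))
      (cong (λ c → (charge (y , ρ') n - charge (x , ρ) n) + - ((x₁ n - c) - charge (x , ρ) n))
            (φ-cong (λ e → cong toℤ (sym (ρ₁≗ρ' e))) n))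
    cancel : ∀ y x → x + (y - x) ≡ y
    cancel = solve-∀
    finish : IsFiring (λ n → y n - x₁ n) → Reach G (x , ρ) (y , ρ')
    finish (k , y-x₁≗) = Reach-trans reach₁ (Reach-trans (fire-reachable k x₁ ρ₁) (≈⇒Reach (chips , ρ₁≗ρ')))
      where
      chips : ∀ n → x₁ n + fire k n ≡ y n
      chips n = trans (cong (λ c → x₁ n + c) (sym (y-x₁≗ n))) (cancel (y n) (x₁ n))

  module SignedCycle (C : CycleSet G) (c₁ c₂ : D) (separate : ¬ Conn G C c₁ c₂)
                     (cover : ∀ x → Conn G C x c₁ ⊎ Conn G C x c₂) (c : D) where

    Conn-sym : ∀ {x y} → Conn G C x y → Conn G C y x
    Conn-sym = EqClosure.symmetric (CellAdj G C)

    Conn⇒same-side : ∀ {x y} (u : Conn G C x c₁ ⊎ Conn G C x c₂) (w : Conn G C y c₁ ⊎ Conn G C y c₂) →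
                     Conn G C x y → isLeft u ≡ isLeft w
    Conn⇒same-side (inj₁ _) (inj₁ _) _ = refl
    Conn⇒same-side (inj₂ _) (inj₂ _) _ = refl
    Conn⇒same-side (inj₁ x~₁) (inj₂ y~₂) x~y = contradiction (Conn-sym x~₁ ◅◅ x~y ◅◅ y~₂) separate
    Conn⇒same-side (inj₂ x~₂) (inj₁ y~₁) x~y = contradiction (Conn-sym y~₁ ◅◅ Conn-sym x~y ◅◅ x~₂) separate

    same-side⇒Conn : ∀ {x y} (u : Conn G C x c₁ ⊎ Conn G C x c₂) (w : Conn G C y c₁ ⊎ Conn G C y c₂) →
                     isLeft u ≡ isLeft w → Conn G C x y
    same-side⇒Conn (inj₁ x~₁) (inj₁ y~₁) _ = x~₁ ◅◅ Conn-sym y~₁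
    same-side⇒Conn (inj₂ x~₂) (inj₂ y~₂) _ = x~₂ ◅◅ Conn-sym y~₂
    same-side⇒Conn (inj₁ _) (inj₂ _) ()
    same-side⇒Conn (inj₂ _) (inj₁ _) ()

    side : D → Bool
    side x = isLeft (cover x)

    inside : D → ℤ
    inside x = toℤ ⌊ side x Bool.≟ side c ⌋

    inside-resp : ∀ {x y} → Conn G C x y → inside x ≡ inside y
    inside-resp {x} {y} x~y = cong (λ s → toℤ ⌊ s Bool.≟ side c ⌋) (Conn⇒same-side (cover x) (cover y) x~y)

    Ind⇒inside : ∀ x k → Ind G C c x k → k ≡ inside x
    Ind⇒inside x k (inj₁ (c~x , refl)) = sym (if-yes (side x Bool.≟ side c) (Conn⇒same-side (cover x) (cover c) (Conn-sym c~x)))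
    Ind⇒inside x k (inj₂ (c≁x , refl)) =
      sym (if-no (side x Bool.≟ side c) (λ same → c≁x (Conn-sym (same-side⇒Conn (cover x) (cover c) same))))

    across-primal : ∀ n b → C n ≢ primal → Conn G C (σ⁻ G (n , b)) (n , b)
    across-primal n b C≢primal =
      fwd (inj₁ (sym (σσ⁻ G (n , b)) , λ eq → C≢primal (trans (cong (λ d → C (edgeOf d)) (sym (σσ⁻ G (n , b)))) eq))) ◅ ε

    across-dual : ∀ n b → C n ≢ dual → Conn G C (σ⁻ G (n , b)) (n , not b)
    across-dual n b C≢dual =
      fwd (inj₂ (sym (cong α (σσ⁻ G (n , b))) , λ eq → C≢dual (trans (cong (λ d → C (edgeOf d)) (sym (σσ⁻ G (n , b)))) eq))) ◅ ε

    primal-or-not : ∀ (t : Tag G) → t ≡ primal ⊎ t ≢ primal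
    primal-or-not none = inj₂ λ ()
    primal-or-not primal = inj₁ refl
    primal-or-not dual = inj₂ λ ()

    -- The four cells around node n pair up across whichever of the halves of n and n* avoid C.
    inside-balanced : ∀ n → inside (n , false) + inside (n , true) ≡ inside (σ⁻ G (n , false)) + inside (σ⁻ G (n , true))
    inside-balanced n with primal-or-not (C n)
    ... | inj₂ C≢primal = sym (cong₂ _+_ (inside-resp (across-primal n false C≢primal))
                                         (inside-resp (across-primal n true C≢primal)))
    ... | inj₁ C≡primal = trans (ℤP.+-comm (inside (n , false)) (inside (n , true)))
                                (sym (cong₂ _+_ (inside-resp (across-dual n false C≢dual))
                                                (inside-resp (across-dual n true C≢dual))))
      where
      C≢dual : C n ≢ dual
      C≢dual C≡dual = contradiction (trans (sym C≡primal) C≡dual) λ ()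

    SignedCyclePi⇒inside : ∀ z → SignedCyclePi G C c z → z ≗ (λ e → inside (e , false) - inside (e , true))
    SignedCyclePi⇒inside z signed e with signed e
    ... | inj₂ (_ , k₁ , k₂ , ind₁ , ind₂ , z≡) = trans z≡ (cong₂ _-_ (Ind⇒inside _ k₁ ind₁) (Ind⇒inside _ k₂ ind₂))
    ... | inj₁ (C≡none , z≡) =
      trans z≡ (sym (trans (cong (λ i → i - inside (e , true)) both) (ℤP.+-inverseʳ (inside (e , true)))))
      where
      both : inside (e , false) ≡ inside (e , true)
      both = inside-resp (Conn-sym (across-dual e true (λ p → contradiction (trans (sym C≡none) p) λ ()))
                          ◅◅ across-primal e true (λ p → contradiction (trans (sym C≡none) p) λ ()))
    φ-SignedCyclePi : ∀ z → SignedCyclePi G C c z → IsFiring (φ G z)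
    φ-SignedCyclePi z signed = insideT , λ n →
      trans (φ-cong (SignedCyclePi⇒inside z signed) n) (rearrange n)
      where
      insideF insideT : Chips G
      insideF e = inside (e , false)
      insideT e = inside (e , true)
      arcs : ∀ n → inflow false n insideF + inflow true n insideT ≡ insideF n + insideT n
      arcs n = trans (inflow-arcs inside n) (sym (inside-balanced n))
      rearrange : ∀ n → φ G (λ e → insideF e - insideT e) n ≡ fire insideT n
      rearrange n = begin
        (insideF n - insideT n) - inflow false n (λ e → insideF e - insideT e)
          ≡⟨ cong (λ s → (insideF n - insideT n) - s)
                  (trans (inflow-+ false n insideF (λ e → - insideT e)) (cong (λ s → inflow false n insideF + s) (inflow-neg false n insideT))) ⟩
        (insideF n - insideT n) - (inflow false n insideF - inflow false n insideT)
          ≡⟨ solve-arcs (insideF n) (insideT n) (inflow false n insideF) (inflow false n insideT) (inflow true n insideT) (arcs n) ⟩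
        fire insideT n ∎
        where
        open ≡-Reasoning
        solve-arcs : ∀ f t p q r → p + r ≡ f + t → (f - t) - (p - q) ≡ (q + r) - (t + t)
        solve-arcs f t p q r eq = trans (before f t p q) (trans (cong (λ s → (s - (t + t)) - (p - q)) (sym eq)) (after t p q r))
          where
          before : ∀ f t p q → (f - t) - (p - q) ≡ ((f + t) - (t + t)) - (p - q)
          before = solve-∀
          after : ∀ t p q r → ((p + r) - (t + t)) - (p - q) ≡ (q + r) - (t + t)
          after = solve-∀

  JStep⇒IsFiring : ∀ {x y} → JStep G x y → IsFiring (λ n → φ G y n - φ G x n)
  JStep⇒IsFiring {x} {y} (C , c , z , ((c₁ , c₂ , separate , cover) , _) , signed , y≗) =
    IsFiring-resp (SignedCycle.φ-SignedCyclePi C c₁ c₂ separate cover c z signed) λ n →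
      trans (cong (λ s → s - φ G x n) (trans (φ-cong y≗ n) (φ-+ x z n))) (cancel (φ G x n) (φ G z n))
    where
    cancel : ∀ a b → (a + b) - a ≡ b
    cancel = solve-∀

  EqClosure⇒IsFiring : ∀ {x y} → EqClosure.EqClosure (JStep G) x y → IsFiring (λ n → φ G y n - φ G x n)
  EqClosure⇒IsFiring {x} ε = IsFiring-zero (λ n → ℤP.+-inverseʳ (φ G x n))
  EqClosure⇒IsFiring {x} {y} (_◅_ {j = j} (fwd step) rest) =
    IsFiring-add (EqClosure⇒IsFiring rest) (JStep⇒IsFiring {x} {j} step) (λ n → telescope (φ G y n) (φ G j n) (φ G x n))
  EqClosure⇒IsFiring {x} {y} (_◅_ {j = j} (bwd step) rest) =
    IsFiring-add (EqClosure⇒IsFiring rest) (IsFiring-neg (JStep⇒IsFiring {j} {x} step) (λ _ → refl))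
                 (λ n → telescope′ (φ G y n) (φ G j n) (φ G x n))
    where
    telescope′ : ∀ a b c → a - c ≡ (a - b) + - (c - b)
    telescope′ = solve-∀

  ActsTo⇒IsFiring : ∀ v O₁ O₂ → ActsTo G v O₁ O₂ → IsFiring (φ G (λ e → v e + orDiff G (O₁ e) (O₂ e)))
  ActsTo⇒IsFiring v O₁ O₂ (y , w∼y , y≗0) = IsFiring-neg (EqClosure⇒IsFiring w∼y) λ n →
    trans (negate (φ G w n)) (cong (λ s → - (s - φ G w n)) (sym (φy≗0 n)))
    where
    w : Fin M → ℤ
    w e = v e + orDiff G (O₁ e) (O₂ e)
    negate : ∀ a → a ≡ - (+ 0 - a)
    negate = solve-∀
    φy≗0 : φ G y ≗ (λ _ → + 0)
    φy≗0 n = trans (φ-cong y≗0 n) (cong (λ s → + 0 - s) (inflow-zero false n))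

  module Positions (g : ℕ → D) (a : D) where

    search-finds : ∀ n i j → i ≤ j → j < i ℕ.+ n → g j ≡ a → search G g a i n ≤ j × g (search G g a i n) ≡ a
    search-finds zero i j i≤j j<i+0 _ = contradiction (ℕP.≤-<-trans i≤j (subst (j <_) (ℕP.+-identityʳ i) j<i+0)) (ℕP.<-irrefl refl)
    search-finds (suc n) i j i≤j j<i+n gj with g i ≟D a
    ... | yes gi = i≤j , gi
    ... | no gi≢a with i ℕ.≟ j
    ...   | yes refl = contradiction gj gi≢a
    ...   | no i≢j = search-finds n (suc i) j (ℕP.≤∧≢⇒< i≤j i≢j) (subst (j <_) (ℕP.+-suc i n) j<i+n) gj

    search-minimal : ∀ n i j → i ≤ j → j < search G g a i n → g j ≢ a
    search-minimal zero i j i≤j j<i = contradiction (ℕP.≤-<-trans i≤j j<i) (ℕP.<-irrefl refl)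
    search-minimal (suc n) i j i≤j j<s with g i ≟D a
    ... | yes gi = contradiction (ℕP.≤-<-trans i≤j j<s) (ℕP.<-irrefl refl)
    ... | no gi≢a with i ℕ.≟ j
    ...   | yes refl = gi≢a
    ...   | no i≢j = search-minimal n (suc i) j (ℕP.≤∧≢⇒< i≤j i≢j) j<s

    pos-finds : ∀ j → j < 2 ℕ.* M → g j ≡ a → pos G g a ≤ j × g (pos G g a) ≡ a
    pos-finds j j<2M = search-finds (2 ℕ.* M) 0 j z≤n j<2M

    pos-minimal : ∀ j → j < pos G g a → g j ≢ a
    pos-minimal j = search-minimal (2 ℕ.* M) 0 j z≤n

    pos-unique : ∀ s → g s ≡ a → s < 2 ℕ.* M → (∀ j → j < s → g j ≢ a) → pos G g a ≡ s
    pos-unique s gs s<2M earlier with pos-finds s s<2M gs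
    ... | pos≤s , g-pos with ℕP.<-cmp (pos G g a) s
    ...   | tri< pos<s _ _ = contradiction g-pos (earlier _ pos<s)
    ...   | tri≈ _ pos≡s _ = pos≡s
    ...   | tri> _ _ s<pos = contradiction (ℕP.<-≤-trans s<pos pos≤s) (ℕP.<-irrefl refl)

  open Positions public

  search-cong : ∀ (g h : ℕ → D) a b → (∀ i → ⌊ g i ≟D a ⌋ ≡ ⌊ h i ≟D b ⌋) →
                ∀ i n → search G g a i n ≡ search G h b i n
  search-cong g h a b same i zero = refl
  search-cong g h a b same i (suc n) rewrite same i | search-cong g h a b same (suc i) n = refl

  encode : D → Fin (M ℕ.+ M)
  encode (e , false) = e ↑ˡ M
  encode (e , true) = M ↑ʳ e

  decode : Fin (M ℕ.+ M) → D
  decode i = [ (λ e → e , false) , (λ e → e , true) ]′ (splitAt M i)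

  decode-encode : ∀ d → decode (encode d) ≡ d
  decode-encode (e , false) rewrite FinP.splitAt-↑ˡ M e M = refl
  decode-encode (e , true) rewrite FinP.splitAt-↑ʳ M M e = refl

  encode-injective : ∀ {d d'} → encode d ≡ encode d' → d ≡ d'
  encode-injective {d} {d'} eq = trans (sym (decode-encode d)) (trans (cong decode eq) (decode-encode d'))

  eventually-periodic : ∀ (E : D → D) a → ∃[ p ] ∃[ q ] p < q × q ≤ 2 ℕ.* M × iter E p a ≡ iter E q a
  eventually-periodic E a with FinP.pigeonhole (ℕP.n<1+n (M ℕ.+ M)) (λ i → encode (iter E (toℕ i) a))
  ... | i , j , i<j , eq =
    toℕ i , toℕ j , i<j , subst (toℕ j ≤_) (sym 2M≡M+M) (ℕP.m<1+n⇒m≤n (FinP.toℕ<n j)) , encode-injective eq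
    where
    2M≡M+M : 2 ℕ.* M ≡ M ℕ.+ M
    2M≡M+M = cong (M ℕ.+_) (ℕP.+-identityʳ M)

  iter-below-period : ∀ (E : D → D) a p q → p < q → iter E p a ≡ iter E q a →
                      ∀ k → ∃[ l ] l < q × iter E l a ≡ iter E k a
  iter-below-period E a p q p<q eq zero = 0 , ℕP.≤-<-trans z≤n p<q , refl
  iter-below-period E a p q p<q eq (suc k) with iter-below-period E a p q p<q eq k
  ... | l , l<q , el with suc l ℕ.≟ q
  ...   | yes 1+l≡q = p , p<q , trans eq (trans (cong (λ t → iter E t a) (sym 1+l≡q)) (cong E el))
  ...   | no 1+l≢q = suc l , ℕP.≤∧≢⇒< l<q 1+l≢q , cong E el

  reached-within-2M : ∀ (E : D → D) → (∀ a x → ∃[ k ] iter E k a ≡ x) → ∀ a x → ∃[ i ] i < 2 ℕ.* M × iter E i a ≡ x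
  reached-within-2M E reached a x with eventually-periodic E a
  ... | p , q , p<q , q≤2M , eq with reached a x
  ...   | k , ek with iter-below-period E a p q p<q eq k
  ...     | l , l<q , el = l , ℕP.<-≤-trans l<q q≤2M , trans el ek

  -- E is the successor map of an Eulerian tour of G⋈ on its arcs: arc d ends at node edgeOf (σ d).
  module TourRotor (E : D → D) (E-leaves-head : ∀ d → edgeOf (E d) ≡ edgeOf (σ G d))
                   (reached : ∀ a x → ∃[ k ] iter E k a ≡ x) where

    walk : D → ℕ → D
    walk a k = iter E k a

    ρ : D → Rotor G
    ρ = tourRotor G E

    found : ∀ a x → pos G (walk a) x < 2 ℕ.* M × walk a (pos G (walk a) x) ≡ x
    found a x with reached-within-2M E reached a x
    ... | i , i<2M , ei with pos-finds (walk a) x i i<2M ei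
    ...   | pos≤i , hit = ℕP.≤-<-trans pos≤i i<2M , hit

    E≢id : ∀ a → E a ≢ a
    E≢id a Ea≡a = α≢ a (trans (sym (proj₂ (reached a (α a)))) (stays (proj₁ (reached a (α a)))))
      where
      stays : ∀ k → walk a k ≡ a
      stays zero = refl
      stays (suc k) = trans (cong E (stays k)) Ea≡a

    pos-advance : ∀ a x → x ≢ a → suc (pos G (walk (E a)) x) ≡ pos G (walk a) x
    pos-advance a x x≢a with pos G (walk a) x in eq
    ... | zero = contradiction (trans (sym (subst (λ r → walk a r ≡ x) eq (proj₂ (found a x)))) refl) x≢a
    ... | suc r = cong suc (pos-unique (walk (E a)) x r
                   (trans (iter-suc E r a) (subst (λ r → walk a r ≡ x) eq (proj₂ (found a x))))
                   (ℕP.<-trans (ℕP.n<1+n r) (subst (_< 2 ℕ.* M) eq (proj₁ (found a x))))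
                   (λ j j<r hit → pos-minimal (walk a) x (suc j) (subst (suc j <_) (sym eq) (s<s j<r))
                                    (trans (sym (iter-suc E j a)) hit)))

    α-before-return : ∀ a → pos G (walk (E a)) (α a) < pos G (walk (E a)) a
    α-before-return a with found (E a) a | found (E a) (α a)
    ... | _ , hit-a | _ , hit-α with ℕP.<-cmp (pos G (walk (E a)) (α a)) (pos G (walk (E a)) a)
    ...   | tri< lt _ _ = lt
    ...   | tri≈ _ eq _ = contradiction (trans (sym hit-α) (trans (cong (walk (E a)) eq) hit-a)) (α≢ a)
    ...   | tri> _ _ gt = contradiction again (pos-minimal (walk (E a)) (α a) u u<t)
      where
      s t u : ℕ
      s = pos G (walk (E a)) a
      t = pos G (walk (E a)) (α a)
      u = t ∸ suc s
      u+s+1≡t : u ℕ.+ suc s ≡ t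
      u+s+1≡t = ℕP.m∸n+n≡m gt
      u<t : u < t
      u<t = subst (u <_) u+s+1≡t (ℕP.m<m+n u z<s)
      again : walk (E a) u ≡ α a
      again = trans (cong (iter E u) (cong E (sym hit-a)))
                (trans (sym (iter-+ E u (suc s) (E a))) (trans (cong (λ k → iter E k (E a)) u+s+1≡t) hit-α))

    rotor-at-next : ∀ a → ρ a (edgeOf (E a)) ≡ not (sideOf (E a))
    rotor-at-next a with edgeOf (E a) Fin.≟ edgeOf a
    ... | yes same = BoolP.¬-not (λ eq → E≢id a (cong₂ _,_ same (sym eq)))
    ... | no differ = by-side (sideOf (E a)) refl
      where
      e' : Fin M
      e' = edgeOf (E a)
      P : D → ℕ
      P = pos G (walk a)
      first : P (E a) ≡ 1
      first = pos-unique (walk a) (E a) 1 refl (1<2*size e')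
                λ { zero _ eq → E≢id a (sym eq) ; (suc j) (s≤s ()) }
      later : 1 < P (α (E a))
      later with P (α (E a)) in eq
      ... | zero = contradiction (cong edgeOf (trans (sym (proj₂ (found a (α (E a))))) (cong (walk a) eq))) differ
      ... | suc zero = contradiction (trans (sym (proj₂ (found a (α (E a))))) (cong (walk a) eq)) (α≢ (E a))
      ... | suc (suc _) = s≤s (s≤s z≤n)
      by-side : ∀ b → sideOf (E a) ≡ b → (P (e' , false) <ᵇ P (e' , true)) ≡ not b
      by-side false eq = trans (cong₂ _<ᵇ_ (trans (cong (λ b → P (e' , b)) (sym eq)) first)
                                           (cong (λ b → P (e' , not b)) (sym eq)))
                               (<ᵇ-true later)
      by-side true eq = trans (cong₂ _<ᵇ_ (cong (λ b → P (e' , not b)) (sym eq))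
                                          (trans (cong (λ b → P (e' , b)) (sym eq)) first))
                              (<ᵇ-false (ℕP.<⇒≤ later))

    rotor-elsewhere : ∀ a n → n ≢ edgeOf (E a) → ρ (E a) n ≡ ρ a n
    rotor-elsewhere a n n≢e' = trans (if-no (n Fin.≟ edgeOf (E a)) n≢e') (by-node (n Fin.≟ edgeOf a))
      where
      P : D → ℕ
      P = pos G (walk (E a))
      by-node : Dec (n ≡ edgeOf a) → (P (n , false) <ᵇ P (n , true)) ≡ ρ a n
      by-node (yes refl) = trans (by-side (sideOf a) refl) (sym (if-yes (n Fin.≟ n) refl))
        where
        by-side : ∀ b → sideOf a ≡ b → (P (n , false) <ᵇ P (n , true)) ≡ b
        by-side true eq = trans (cong₂ (λ b b' → P (n , b) <ᵇ P (n , b')) (cong not (sym eq)) (sym eq))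
                                (<ᵇ-true (α-before-return a))
        by-side false eq = trans (cong₂ (λ b b' → P (n , b) <ᵇ P (n , b')) (sym eq) (cong not (sym eq)))
                                 (<ᵇ-false (ℕP.<⇒≤ (α-before-return a)))
      by-node (no n≢e) =
        trans (cong₂ _<ᵇ_ (pos-advance a (n , false) (λ p → n≢e (cong proj₁ p)))
                          (pos-advance a (n , true) (λ p → n≢e (cong proj₁ p))))
              (sym (if-no (n Fin.≟ edgeOf a) n≢e))

    rotor-advance : ∀ a → ρ (E a) ≗ flipAt (edgeOf (E a)) (ρ a)
    rotor-advance a n = by-node (n Fin.≟ edgeOf (E a))
      where
      by-node : Dec (n ≡ edgeOf (E a)) → ρ (E a) n ≡ flipAt (edgeOf (E a)) (ρ a) n
      by-node (yes n≡e') = begin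
        ρ (E a) n                            ≡⟨ if-yes (n Fin.≟ edgeOf (E a)) n≡e' ⟩
        sideOf (E a)                         ≡⟨ sym (BoolP.not-involutive _) ⟩
        not (not (sideOf (E a)))             ≡⟨ cong not (sym (rotor-at-next a)) ⟩
        not (ρ a (edgeOf (E a)))             ≡⟨ sym (if-yes (n Fin.≟ edgeOf (E a)) n≡e') ⟩
        flipAt (edgeOf (E a)) (ρ a) n        ∎
        where open ≡-Reasoning
      by-node (no n≢e') = trans (rotor-elsewhere a n n≢e') (sym (if-no (n Fin.≟ edgeOf (E a)) n≢e'))

    -- Moving the start of the tour from a to E a is one routing, at the head of a.
    advance-Reach : ∀ a → Reach G (single (+ 1) (edgeOf (σ G a)) , ρ a) (single (+ 1) (edgeOf (σ G (E a))) , ρ (E a))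
    advance-Reach a = Reach-trans (routeAt-Reach (edgeOf (E a)) _) (≈⇒Reach (chips , λ n → sym (rotor-advance a n)))
      where
      next : (edgeOf (E a) , not (ρ a (edgeOf (E a)))) ≡ E a
      next = cong (edgeOf (E a) ,_) (trans (cong not (rotor-at-next a)) (BoolP.not-involutive _))
      chips : ∀ n → (single (+ 1) (edgeOf (σ G a)) n - single (+ 1) (edgeOf (E a)) n)
                      + single (+ 1) (edgeOf (σ G (edgeOf (E a) , not (ρ a (edgeOf (E a)))))) n
                    ≡ single (+ 1) (edgeOf (σ G (E a))) n
      chips n = trans (cong₂ (λ u w → (single (+ 1) (edgeOf (σ G a)) n - single (+ 1) u n) + single (+ 1) (edgeOf (σ G w)) n)
                             (E-leaves-head a) next)
                      (cancel (single (+ 1) (edgeOf (σ G a)) n) _)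
        where
        cancel : ∀ x y → (x - x) + y ≡ y
        cancel = solve-∀

    walk-Reach : ∀ t a → Reach G (single (+ 1) (edgeOf (σ G a)) , ρ a) (single (+ 1) (edgeOf (σ G (walk a t))) , ρ (walk a t))
    walk-Reach zero a = ≈⇒Reach ≈-refl
    walk-Reach (suc t) a = Reach-trans (walk-Reach t a) (advance-Reach (walk a t))

    tour-Reach : ∀ a b → Reach G (single (+ 1) (edgeOf (σ G a)) , ρ a) (single (+ 1) (edgeOf (σ G b)) , ρ b)
    tour-Reach a b with reached a b
    ... | t , refl = walk-Reach t a

  τ-leaves-head : ∀ Q d → edgeOf (τ G Q d) ≡ edgeOf (σ G d)
  τ-leaves-head Q d with Q (edgeOf (σ G d))
  ... | true = refl
  ... | false = refl

  module QuasiTreeTour (Q : Subgraph G) (qt : QuasiTree G Q) where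

    open TourRotor (τ G Q) (τ-leaves-head Q) qt public

    -- The half-edge with label l is crossed by the medial arc crossingArc l.
    crossingArc : D → D
    crossingArc l = if Q (edgeOf l) then α l else l

    crossingArc-involutive : ∀ l → crossingArc (crossingArc l) ≡ l
    crossingArc-involutive (e , b) with Q e in eq
    ... | true rewrite eq = cong (e ,_) (BoolP.not-involutive b)
    ... | false rewrite eq = refl

    crossingArc-injective : ∀ {l l'} → crossingArc l ≡ crossingArc l' → l ≡ l'
    crossingArc-injective {l} {l'} eq =
      trans (sym (crossingArc-involutive l)) (trans (cong crossingArc eq) (crossingArc-involutive l'))

    ⌊≟D⌋-crossingArc : ∀ l l' → ⌊ l ≟D l' ⌋ ≡ ⌊ crossingArc l ≟D crossingArc l' ⌋
    ⌊≟D⌋-crossingArc l l' with l ≟D l' | crossingArc l ≟D crossingArc l'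
    ... | yes _ | yes _ = refl
    ... | no _ | no _ = refl
    ... | yes eq | no neq = contradiction (cong crossingArc eq) neq
    ... | no neq | yes eq = contradiction (crossingArc-injective eq) neq

    module _ (e₀ : Fin M) where

      crossings : ℕ → D
      crossings k = iter (crossNext G Q) k (e₀ , Q e₀)

      crossingArc-crossings : ∀ k → crossingArc (crossings k) ≡ walk (e₀ , false) k
      crossingArc-crossings zero with Q e₀
      ... | true = refl
      ... | false = refl
      crossingArc-crossings (suc k) = cong (τ G Q) (crossingArc-crossings k)

      pos-crossings : ∀ l → pos G crossings l ≡ pos G (walk (e₀ , false)) (crossingArc l)
      pos-crossings l = search-cong crossings (walk (e₀ , false)) l (crossingArc l)
        (λ i → trans (⌊≟D⌋-crossingArc (crossings i) l) (cong (λ d → ⌊ d ≟D crossingArc l ⌋) (crossingArc-crossings i)))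
        0 (2 ℕ.* M)

      position : D → ℕ
      position = pos G (walk (e₀ , false))

      bernardi-pos : ∀ e → bernardi G e₀ Q e ≡ (position (e , true) <ᵇ position (e , false))
      bernardi-pos e with Q e in eq
      ... | true = cong₂ _<ᵇ_ (trans (pos-crossings (e , false)) (cong (λ q → position (if q then (e , true) else (e , false))) eq))
                              (trans (pos-crossings (e , true)) (cong (λ q → position (if q then (e , false) else (e , true))) eq))
      ... | false = cong₂ _<ᵇ_ (trans (pos-crossings (e , true)) (cong (λ q → position (if q then (e , false) else (e , true))) eq))
                               (trans (pos-crossings (e , false)) (cong (λ q → position (if q then (e , true) else (e , false))) eq))

      bernardi-e₀ : bernardi G e₀ Q e₀ ≡ false
      bernardi-e₀ = trans (bernardi-pos e₀) (cong (position (e₀ , true) <ᵇ_) start)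
        where
        start : position (e₀ , false) ≡ 0
        start = pos-unique (walk (e₀ , false)) (e₀ , false) 0 refl (ℕP.≤-<-trans z≤n (1<2*size e₀)) (λ _ ())

      rotor-e₀ : ρ (e₀ , false) e₀ ≡ false
      rotor-e₀ = if-yes (e₀ Fin.≟ e₀) refl

      bernardi-rotor : ∀ e → e ≢ e₀ → bernardi G e₀ Q e ≡ not (ρ (e₀ , false) e)
      bernardi-rotor e e≢e₀ =
        trans (bernardi-pos e) (trans (<ᵇ-flip distinct) (cong not (sym (if-no (e Fin.≟ e₀) e≢e₀))))
        where
        distinct : position (e , false) ≢ position (e , true)
        distinct eq = contradiction (trans (sym (proj₂ (found (e₀ , false) (e , false))))
                                     (trans (cong (walk (e₀ , false)) eq) (proj₂ (found (e₀ , false) (e , true))))) λ ()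

  orDiff-not : ∀ r r' → orDiff G (not r) (not r') ≡ toℤ r' - toℤ r
  orDiff-not false false = refl
  orDiff-not false true = refl
  orDiff-not true false = refl
  orDiff-not true true = refl

  -- The Bernardi orientations of Q and Q' differ exactly as the rotors of their tours started at (e₀ , false).
  bernardi-action : ∀ e₀ Q Q' → QuasiTree G Q → QuasiTree G Q' → ∀ v →
    ActsTo G v (bernardi G e₀ Q) (bernardi G e₀ Q') →
    IsFiring (λ n → φ G v n + (φ G (indicator (tourRotor G (τ G Q') (e₀ , false))) n
                               - φ G (indicator (tourRotor G (τ G Q) (e₀ , false))) n))
  bernardi-action e₀ Q Q' qt qt' v act =
    IsFiring-resp (ActsTo⇒IsFiring v (bernardi G e₀ Q) (bernardi G e₀ Q') act) λ n → sym (begin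
    φ G (λ e → v e + orDiff G (bernardi G e₀ Q e) (bernardi G e₀ Q' e)) n
      ≡⟨ φ-cong (λ e → cong (λ d → v e + d) (orientations e)) n ⟩
    φ G (λ e → v e + (indicator ρ' e + - indicator ρ e)) n
      ≡⟨ φ-+ v _ n ⟩
    φ G v n + φ G (λ e → indicator ρ' e + - indicator ρ e) n
      ≡⟨ cong (λ s → φ G v n + s) (trans (φ-+ (indicator ρ') _ n) (cong (λ s → φ G (indicator ρ') n + s) (φ-neg (indicator ρ) n))) ⟩
    φ G v n + (φ G (indicator ρ') n - φ G (indicator ρ) n) ∎)
    where
    open ≡-Reasoning
    module T = QuasiTreeTour Q qt
    module T' = QuasiTreeTour Q' qt'
    ρ ρ' : Rotor G
    ρ = T.ρ (e₀ , false)
    ρ' = T'.ρ (e₀ , false)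
    orientations : ∀ e → orDiff G (bernardi G e₀ Q e) (bernardi G e₀ Q' e) ≡ toℤ (ρ' e) - toℤ (ρ e)
    orientations e = by-edge (e Fin.≟ e₀)
      where
      at-e₀ : orDiff G (bernardi G e₀ Q e₀) (bernardi G e₀ Q' e₀) ≡ toℤ (ρ' e₀) - toℤ (ρ e₀)
      at-e₀ = trans (cong₂ (orDiff G) (T.bernardi-e₀ e₀) (T'.bernardi-e₀ e₀))
                    (sym (cong₂ (λ r r' → toℤ r' - toℤ r) (T.rotor-e₀ e₀) (T'.rotor-e₀ e₀)))
      by-edge : Dec (e ≡ e₀) → orDiff G (bernardi G e₀ Q e) (bernardi G e₀ Q' e) ≡ toℤ (ρ' e) - toℤ (ρ e)
      by-edge (yes refl) = at-e₀
      by-edge (no e≢e₀) = trans (cong₂ (orDiff G) (T.bernardi-rotor e₀ e e≢e₀) (T'.bernardi-rotor e₀ e e≢e₀))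
                                (orDiff-not (ρ e) (ρ' e))

theorem5p11 : (G : RibbonGraph) (e₀ : Fin (m G)) (v : Fin (m G) → ℤ)
    (Q Q' : Subgraph G) → QuasiTree G Q → QuasiTree G Q' →
    ActsTo G v (bernardi G e₀ Q) (bernardi G e₀ Q') →
    (a : Dart (m G)) →
    Reach G (φ G v , tourRotor G (τ G Q) a) ((λ _ → + 0) , tourRotor G (τ G Q') a)
theorem5p11 G e₀ v Q Q' qt qt' act a =
  charge⇒Reach (IsFiring-add (IsFiring-add (IsFiring-neg acts (λ _ → refl)) tour (λ _ → refl))
                             (IsFiring-neg tour' (λ _ → refl))
                             (λ n → rearrange (φ G v n) (φρ ρ₀ n) (φρ ρ'₀ n) (φρ ρ n) (φρ ρ' n)
                                              (head a₀ n) (head a n)))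
  where
  open Medial G
  a₀ : Dart (m G)
  a₀ = (e₀ , false)
  ρ ρ' ρ₀ ρ'₀ : Rotor G
  ρ = tourRotor G (τ G Q) a
  ρ' = tourRotor G (τ G Q') a
  ρ₀ = tourRotor G (τ G Q) a₀
  ρ'₀ = tourRotor G (τ G Q') a₀
  φρ : Rotor G → Chips G
  φρ r = φ G (indicator r)
  head : Dart (m G) → Chips G
  head d = single (+ 1) (edgeOf (σ G d))
  acts : IsFiring (λ n → φ G v n + (φρ ρ'₀ n - φρ ρ₀ n))
  acts = bernardi-action e₀ Q Q' qt qt' v act
  tour : IsFiring (λ n → charge (head a₀ , ρ₀) n - charge (head a , ρ) n)
  tour = Reach⇒IsFiring (QuasiTreeTour.tour-Reach Q qt a a₀)
  tour' : IsFiring (λ n → charge (head a₀ , ρ'₀) n - charge (head a , ρ') n)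
  tour' = Reach⇒IsFiring (QuasiTreeTour.tour-Reach Q' qt' a a₀)
  rearrange : ∀ x f₀ f'₀ f f' h₀ h →
    (+ 0 - f') - (x - f) ≡ ((- (x + (f'₀ - f₀))) + ((h₀ - f₀) - (h - f))) + - ((h₀ - f'₀) - (h - f'))
  rearrange = solve-∀
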